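{- Let $p$ be a prime, $y\in\mathbb{N}$ and $n\in\mathbb{N}\setminus\{1\}$ with $p>n/2$. If $\phi(y)\le\phi(X_{n,p})$, then $D(W(y),W(X_{n,p}))\ge 1$.
   Context: $\phi$ is Euler's totient function; $W(x)$ is the set of prime divisors of $x$. For $n\in\mathbb{N}$ and prime $p$, $X_{n,p}=\left(n\prod_{q\mid n}q^{ -1}\right)\prod_{q\le p}q$ (products over primes $q$). For finite sets of primes $A,B$, $D(A,B)=\left(\prod_{q\in A}\frac{q-1}{q}\right)\left(\prod_{q\in B}\frac{q}{q-1}\right)$. -}

module Defs where

open import Data.Nat using (ℕ; zero; suc; _∸_)
import Data.Nat as ℕ
open import Data.Nat.DivMod using (_/_)
open import Data.Nat.Divisibility using (_∣?_)
open import Data.Nat.Primality using (prime?)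
open import Data.Nat.Coprimality using (coprime?)
open import Data.List using (List; filter; upTo; map; length; foldr)
open import Data.Integer using (+_)
open import Data.Rational using (ℚ; 0ℚ; 1ℚ; _*_)
import Data.Rational as ℚ
open import Relation.Nullary.Decidable using (_×-dec_)

primesUpTo : ℕ → List ℕ
primesUpTo m = filter prime? (upTo (suc m))

-- W(x): list of prime divisors of x (intended for x ≥ 1), in increasing order
W : ℕ → List ℕ
W x = filter (λ q → prime? q ×-dec q ∣? x) (upTo (suc x))

φ : ℕ → ℕ
φ m = length (filter (λ k → coprime? (suc k) m) (upTo m))

prodℕ : List ℕ → ℕ
prodℕ = foldr ℕ._*_ 1

prodℚ : List ℚ → ℚ
prodℚ = foldr _*_ 1ℚ

-- a / b as a rational (b = 0 never occurs in uses below: b = q or q - 1 with q prime)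
frac : ℕ → ℕ → ℚ
frac a zero = 0ℚ
frac a (suc b) = (+ a) ℚ./ suc b

-- natural division, total (divisor 0 never occurs below)
divℕ : ℕ → ℕ → ℕ
divℕ m zero = 0
divℕ m (suc k) = m / suc k

rad : ℕ → ℕ
rad n = prodℕ (W n)

X : ℕ → ℕ → ℕ
X n p = divℕ n (rad n) ℕ.* prodℕ (primesUpTo p)

D : List ℕ → List ℕ → ℚ
D A B = prodℚ (map (λ q → frac (q ∸ 1) q) A) * prodℚ (map (λ q → frac q (q ∸ 1)) B)

-- With m = n / rad n we have 2m ≤ n < 2p, hence m < p: the prime factors of
-- X = m · ∏_{q ≤ p} q are exactly the primes up to p, and φ(X) = m ∏_{q ≤ p} (q - 1)
-- by the sieve identity φ(x) · rad(x) = x · ∏_{q ∣ x} (q - 1).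
-- Split W(y) into the primes C up to p and the primes U above p, and the primes up
-- to p into C and the remaining V; the factors over C cancel in D.  If |U| ≤ |V|,
-- pair each u ∈ U with its own v ∈ V: since u > v, (u - 1)/u ≥ (v - 1)/v, and the
-- unpaired v contribute factors v/(v - 1) ≥ 1, so D ≥ 1.  If |U| > |V|, the same
-- pairing plus one more factor u - 1 ≥ p gives
-- φ(y) ≥ ∏_{W(y)} (q - 1) ≥ p ∏_{q ≤ p} (q - 1) > φ(X), contrary to the hypothesis.

module Submission where

open import Data.Bool using (Bool; true; false; _∧_; not; if_then_else_)
open import Data.Integer as ℤ using (+_)
import Data.Integer.Properties as ℤP
open import Data.List using (List; []; _∷_; map; filter; upTo; length; _++_; [_])
import Data.List.Properties as ListP
open import Data.List.Membership.Propositional using (_∈_)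
import Data.List.Membership.Propositional.Properties as ∈P
open import Data.List.Relation.Unary.All as All using (All; []; _∷_)
import Data.List.Relation.Unary.All.Properties as AllP
open import Data.List.Relation.Unary.AllPairs using ([]; _∷_)
open import Data.List.Relation.Unary.Unique.Propositional using (Unique)
import Data.List.Relation.Unary.Unique.Propositional.Properties as UniqueP
open import Data.Nat as ℕ using (ℕ; zero; suc; _+_; _*_; _∸_; _≤_; _<_; s≤s; _≤?_; _<?_; NonZero)
import Data.Nat.Properties as ℕP
open import Data.Nat.Coprimality using (Coprime; coprime?)
open import Data.Nat.Divisibility
open import Data.Nat.DivMod using (m*[n/m]≡n)
open import Data.Nat.ListAction.Properties using (∈⇒∣product; product≢0)
open import Data.Nat.Primality using (Prime; prime?; euclidsLemma; prime⇒irreducible; prime⇒nonZero; prime⇒nonTrivial)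
open import Data.Nat.Primality.Factorisation using (factorise; factorisationHasAllPrimeFactors)
open import Data.Nat.Tactic.RingSolver using (solve-∀)
open import Data.Product using (_×_; _,_; proj₁; proj₂; ∃-syntax)
open import Data.Rational as ℚ using (1ℚ; toℚᵘ)
import Data.Rational.Properties as ℚP
open import Data.Rational.Unnormalised as ℚᵘ using (ℚᵘ; mkℚᵘ; 1ℚᵘ)
open import Data.Sum as Sum using (_⊎_; inj₁; inj₂)
open import Function using (_∘_; id; _⇔_; mk⇔; Equivalence)
open import Level using (0ℓ)
open import Relation.Nullary using (¬_; yes; no; does; ¬?; contradiction)
open import Relation.Nullary.Decidable using (_×-dec_; dec-true; dec-false; does-⇔)
open import Relation.Unary using (Pred; Decidable)
open import Relation.Binary.PropositionalEquality hiding ([_])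

open import Defs

import Algebra.Properties.CommutativeSemigroup ℕP.*-commutativeSemigroup as *-Comm
import Algebra.Properties.CommutativeSemigroup ℕP.+-commutativeSemigroup as +-Comm
import Algebra.Properties.CommutativeSemigroup ℤP.*-commutativeSemigroup as ℤ*-Comm

module _ {P Q : Pred ℕ 0ℓ} (P? : Decidable P) (Q? : Decidable Q) where

  filter-filter : ∀ xs → filter P? (filter Q? xs) ≡ filter (λ k → Q? k ×-dec P? k) xs
  filter-filter [] = refl
  filter-filter (x ∷ xs) with Q? x
  ... | no _ = filter-filter xs
  ... | yes _ with P? x
  ...   | yes _ = cong (x ∷_) (filter-filter xs)
  ...   | no _  = filter-filter xs

  filter-cong-All : ∀ {xs} → All (λ k → P k ⇔ Q k) xs → filter P? xs ≡ filter Q? xs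
  filter-cong-All {[]}     []           = refl
  filter-cong-All {x ∷ xs} (P⇔Q ∷ P⇔Qs) with P? x | Q? x
  ... | yes px | yes _  = cong (x ∷_) (filter-cong-All P⇔Qs)
  ... | yes px | no ¬qx = contradiction (Equivalence.to P⇔Q px) ¬qx
  ... | no ¬px | yes qx = contradiction (Equivalence.from P⇔Q qx) ¬px
  ... | no _   | no _   = filter-cong-All P⇔Qs

module _ {P : Pred ℕ 0ℓ} (P? : Decidable P) where

  filter-upTo-+ : ∀ a d → (∀ {k} → a ≤ k → ¬ P k) → filter P? (upTo (a + d)) ≡ filter P? (upTo a)
  filter-upTo-+ a zero    _  = cong (filter P? ∘ upTo) (ℕP.+-identityʳ a)
  filter-upTo-+ a (suc d) ¬P = begin
    filter P? (upTo (a + suc d))                ≡⟨ cong (filter P? ∘ upTo) (ℕP.+-suc a d) ⟩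
    filter P? (upTo (suc (a + d)))              ≡⟨ cong (filter P?) (ListP.upTo-∷ʳ (a + d)) ⟨
    filter P? (upTo (a + d) ++ [ a + d ])       ≡⟨ ListP.filter-++ P? (upTo (a + d)) [ a + d ] ⟩
    filter P? (upTo (a + d)) ++ filter P? [ a + d ]
      ≡⟨ cong (filter P? (upTo (a + d)) ++_) (ListP.filter-reject P? (¬P (ℕP.m≤m+n a d))) ⟩
    filter P? (upTo (a + d)) ++ []              ≡⟨ ListP.++-identityʳ _ ⟩
    filter P? (upTo (a + d))                    ≡⟨ filter-upTo-+ a d ¬P ⟩
    filter P? (upTo a)                          ∎
    where open ≡-Reasoning

filter-upTo-restrict : ∀ {P : Pred ℕ 0ℓ} (P? : Decidable P) a d →
                       filter P? (upTo a) ≡ filter (λ k → k <? a ×-dec P? k) (upTo (a + d))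
filter-upTo-restrict P? a d = begin
  filter P? (upTo a)          ≡⟨ filter-cong-All P? R? (All.tabulate (λ k∈ → mk⇔ (∈P.∈-upTo⁻ k∈ ,_) proj₂)) ⟩
  filter R? (upTo a)          ≡⟨ filter-upTo-+ R? a d (λ a≤k (k<a , _) → ℕP.<⇒≱ k<a a≤k) ⟨
  filter R? (upTo (a + d))    ∎
  where
  open ≡-Reasoning
  R? = λ k → k <? a ×-dec P? k

filter-upTo-≐ : ∀ {P Q : Pred ℕ 0ℓ} (P? : Decidable P) (Q? : Decidable Q) a b →
                (∀ k → (k < a × P k) ⇔ (k < b × Q k)) → filter P? (upTo a) ≡ filter Q? (upTo b)
filter-upTo-≐ P? Q? a b P⇔Q = begin
  filter P? (upTo a)          ≡⟨ filter-upTo-restrict P? a b ⟩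
  filter R? (upTo (a + b))    ≡⟨ ListP.filter-≐ R? S? R≐S (upTo (a + b)) ⟩
  filter S? (upTo (a + b))    ≡⟨ cong (filter S? ∘ upTo) (ℕP.+-comm a b) ⟩
  filter S? (upTo (b + a))    ≡⟨ filter-upTo-restrict Q? b a ⟨
  filter Q? (upTo b)          ∎
  where
  open ≡-Reasoning
  R? = λ k → k <? a ×-dec P? k
  S? = λ k → k <? b ×-dec Q? k
  R≐S = (λ {k} → Equivalence.to (P⇔Q k)) , (λ {k} → Equivalence.from (P⇔Q k))

prodℕ-map-partition : ∀ {P : Pred ℕ 0ℓ} (P? : Decidable P) (f : ℕ → ℕ) xs →
  prodℕ (map f xs) ≡ prodℕ (map f (filter P? xs)) * prodℕ (map f (filter (¬? ∘ P?) xs))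
prodℕ-map-partition P? f [] = refl
prodℕ-map-partition P? f (x ∷ xs) with P? x
... | yes _ = trans (cong (f x *_) (prodℕ-map-partition P? f xs)) (sym (ℕP.*-assoc (f x) _ _))
... | no  _ = trans (cong (f x *_) (prodℕ-map-partition P? f xs))
                    (*-Comm.x∙yz≈y∙xz (f x) (prodℕ (map f (filter P? xs))) _)

prodℕ-partition : ∀ {P : Pred ℕ 0ℓ} (P? : Decidable P) xs →
                  prodℕ xs ≡ prodℕ (filter P? xs) * prodℕ (filter (¬? ∘ P?) xs)
prodℕ-partition P? xs = begin
  prodℕ xs                                                        ≡⟨ cong prodℕ (ListP.map-id xs) ⟨
  prodℕ (map id xs)                                               ≡⟨ prodℕ-map-partition P? id xs ⟩
  prodℕ (map id (filter P? xs)) * prodℕ (map id (filter (¬? ∘ P?) xs))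
    ≡⟨ cong₂ (λ L L′ → prodℕ L * prodℕ L′) (ListP.map-id (filter P? xs)) (ListP.map-id (filter (¬? ∘ P?) xs)) ⟩
  prodℕ (filter P? xs) * prodℕ (filter (¬? ∘ P?) xs)              ∎
  where open ≡-Reasoning

prod∸1 : List ℕ → ℕ
prod∸1 L = prodℕ (map (_∸ 1) L)

prod∸1≤prodℕ : ∀ L → prod∸1 L ≤ prodℕ L
prod∸1≤prodℕ []      = ℕP.≤-refl
prod∸1≤prodℕ (x ∷ L) = ℕP.*-mono-≤ (ℕP.m∸n≤m x 1) (prod∸1≤prodℕ L)

prod∸1-pos : ∀ {L} → All (2 ≤_) L → 1 ≤ prod∸1 L
prod∸1-pos []                = ℕP.≤-refl
prod∸1-pos (s≤s 1≤x ∷ 2≤L) = ℕP.*-mono-≤ 1≤x (prod∸1-pos 2≤L)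

*-∸1-≤ : ∀ {u v} → v ≤ u → u * (v ∸ 1) ≤ (u ∸ 1) * v
*-∸1-≤ {u}     {zero}  _         = ℕP.≤-reflexive (trans (ℕP.*-zeroʳ u) (sym (ℕP.*-zeroʳ (u ∸ 1))))
*-∸1-≤ {suc a} {suc b} (s≤s b≤a) = begin
  suc a * b    ≤⟨ ℕP.+-monoˡ-≤ (a * b) b≤a ⟩
  a + a * b    ≡⟨ ℕP.*-suc a b ⟨
  a * suc b    ∎
  where open ℕP.≤-Reasoning

prod-cross-≤ : ∀ {c} U V → All (c <_) U → All (_≤ c) V → length U ≤ length V →
               prodℕ U * prod∸1 V ≤ prod∸1 U * prodℕ V
prod-cross-≤ []      V       _           _           _             = ℕP.+-monoˡ-≤ 0 (prod∸1≤prodℕ V)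
prod-cross-≤ (u ∷ U) (v ∷ V) (c<u ∷ c<U) (v≤c ∷ V≤c) (s≤s |U|≤|V|) = begin
  (u * prodℕ U) * ((v ∸ 1) * prod∸1 V)   ≡⟨ *-Comm.interchange u (prodℕ U) (v ∸ 1) (prod∸1 V) ⟩
  (u * (v ∸ 1)) * (prodℕ U * prod∸1 V)   ≤⟨ ℕP.*-mono-≤ (*-∸1-≤ (ℕP.≤-trans v≤c (ℕP.<⇒≤ c<u)))
                                                         (prod-cross-≤ U V c<U V≤c |U|≤|V|) ⟩
  ((u ∸ 1) * v) * (prod∸1 U * prodℕ V)   ≡⟨ *-Comm.interchange (u ∸ 1) v (prod∸1 U) (prodℕ V) ⟩
  ((u ∸ 1) * prod∸1 U) * (v * prodℕ V)   ∎
  where open ℕP.≤-Reasoning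

*-prod∸1-≤ : ∀ c U V → 1 ≤ c → All (c <_) U → All (_≤ c) V → length V < length U →
             c * prod∸1 V ≤ prod∸1 U
*-prod∸1-≤ c (u ∷ U) [] 1≤c (c<u ∷ c<U) [] _ = begin
  c * 1              ≡⟨ ℕP.*-identityʳ c ⟩
  c                  ≤⟨ ℕP.∸-monoˡ-≤ 1 c<u ⟩
  u ∸ 1              ≡⟨ ℕP.*-identityʳ (u ∸ 1) ⟨
  (u ∸ 1) * 1        ≤⟨ ℕP.*-monoʳ-≤ (u ∸ 1) (prod∸1-pos (All.map (ℕP.≤-trans (s≤s 1≤c)) c<U)) ⟩
  (u ∸ 1) * prod∸1 U ∎
  where open ℕP.≤-Reasoning
*-prod∸1-≤ c (u ∷ U) (v ∷ V) 1≤c (c<u ∷ c<U) (v≤c ∷ V≤c) (s≤s |V|<|U|) = begin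
  c * ((v ∸ 1) * prod∸1 V)   ≡⟨ *-Comm.x∙yz≈y∙xz c (v ∸ 1) (prod∸1 V) ⟩
  (v ∸ 1) * (c * prod∸1 V)   ≤⟨ ℕP.*-mono-≤ (ℕP.∸-monoˡ-≤ 1 (ℕP.≤-trans v≤c (ℕP.<⇒≤ c<u)))
                                             (*-prod∸1-≤ c U V 1≤c c<U V≤c |V|<|U|) ⟩
  (u ∸ 1) * prod∸1 U         ∎
  where open ℕP.≤-Reasoning

prod-exchange : ∀ c C U V → 1 ≤ c → All (c <_) U → All (_≤ c) V →
  (prodℕ C * prodℕ U) * (prod∸1 C * prod∸1 V) ≤ (prod∸1 C * prod∸1 U) * (prodℕ C * prodℕ V)
  ⊎ c * (prod∸1 C * prod∸1 V) ≤ prod∸1 C * prod∸1 U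
prod-exchange c C U V 1≤c c<U V≤c with length U ℕ.≤? length V
... | yes |U|≤|V| = inj₁ (begin
  (ΠC * ΠU) * (Π′C * Π′V)               ≡⟨ *-Comm.interchange ΠC ΠU Π′C Π′V ⟩
  (ΠC * Π′C) * (ΠU * Π′V)               ≤⟨ ℕP.*-monoʳ-≤ (ΠC * Π′C) (prod-cross-≤ U V c<U V≤c |U|≤|V|) ⟩
  (ΠC * Π′C) * (Π′U * ΠV)               ≡⟨ cong (_* (Π′U * ΠV)) (ℕP.*-comm ΠC Π′C) ⟩
  (Π′C * ΠC) * (Π′U * ΠV)               ≡⟨ *-Comm.interchange Π′C ΠC Π′U ΠV ⟩
  (Π′C * Π′U) * (ΠC * ΠV)               ∎)
  where
  open ℕP.≤-Reasoning
  ΠC = prodℕ C; ΠU = prodℕ U; ΠV = prodℕ V; Π′C = prod∸1 C; Π′U = prod∸1 U; Π′V = prod∸1 V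
... | no  |U|≰|V| = inj₂ (begin
  c * (Π′C * Π′V)             ≡⟨ *-Comm.x∙yz≈y∙xz c Π′C Π′V ⟩
  Π′C * (c * Π′V)             ≤⟨ ℕP.*-monoʳ-≤ Π′C (*-prod∸1-≤ c U V 1≤c c<U V≤c (ℕP.≰⇒> |U|≰|V|)) ⟩
  Π′C * prod∸1 U              ∎)
  where
  open ℕP.≤-Reasoning
  Π′C = prod∸1 C; Π′V = prod∸1 V

-- Rationals by cross-multiplication

record _≈_÷_ (u : ℚᵘ) (a b : ℕ) : Set where
  constructor mk≈÷
  field
    cross-≡ : ℚᵘ.↥ u ℤ.* + b ≡ + a ℤ.* ℚᵘ.↧ u

infix 4 _≈_÷_

≈÷-resp-≃ : ∀ {u v a b} → u ℚᵘ.≃ v → v ≈ a ÷ b → u ≈ a ÷ b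
≈÷-resp-≃ {u} {mkℚᵘ n k} {a} {b} (ℚᵘ.*≡* u≃v) (mk≈÷ v≈) = mk≈÷ (ℤP.*-cancelʳ-≡ _ _ (+ suc k) (begin
  (ℚᵘ.↥ u ℤ.* + b) ℤ.* + suc k   ≡⟨ ℤ*-Comm.xy∙z≈xz∙y (ℚᵘ.↥ u) (+ b) (+ suc k) ⟩
  (ℚᵘ.↥ u ℤ.* + suc k) ℤ.* + b   ≡⟨ cong (ℤ._* + b) u≃v ⟩
  (n ℤ.* ℚᵘ.↧ u) ℤ.* + b         ≡⟨ ℤ*-Comm.xy∙z≈xz∙y n (ℚᵘ.↧ u) (+ b) ⟩
  (n ℤ.* + b) ℤ.* ℚᵘ.↧ u         ≡⟨ cong (ℤ._* ℚᵘ.↧ u) v≈ ⟩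
  (+ a ℤ.* + suc k) ℤ.* ℚᵘ.↧ u   ≡⟨ ℤ*-Comm.xy∙z≈xz∙y (+ a) (+ suc k) (ℚᵘ.↧ u) ⟩
  (+ a ℤ.* ℚᵘ.↧ u) ℤ.* + suc k   ∎))
  where open ≡-Reasoning

≈÷-* : ∀ {u v a b c d} → u ≈ a ÷ b → v ≈ c ÷ d → u ℚᵘ.* v ≈ a * c ÷ (b * d)
≈÷-* {mkℚᵘ n k} {mkℚᵘ m l} {a} {b} {c} {d} (mk≈÷ u≈) (mk≈÷ v≈) = mk≈÷ (begin
  (n ℤ.* m) ℤ.* + (b * d)                   ≡⟨ cong ((n ℤ.* m) ℤ.*_) (ℤP.pos-* b d) ⟩
  (n ℤ.* m) ℤ.* (+ b ℤ.* + d)               ≡⟨ ℤ*-Comm.interchange n m (+ b) (+ d) ⟩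
  (n ℤ.* + b) ℤ.* (m ℤ.* + d)               ≡⟨ cong₂ ℤ._*_ u≈ v≈ ⟩
  (+ a ℤ.* + suc k) ℤ.* (+ c ℤ.* + suc l)   ≡⟨ ℤ*-Comm.interchange (+ a) (+ suc k) (+ c) (+ suc l) ⟩
  (+ a ℤ.* + c) ℤ.* (+ suc k ℤ.* + suc l)   ≡⟨ cong₂ ℤ._*_ (ℤP.pos-* a c) (ℤP.pos-* (suc k) (suc l)) ⟨
  + (a * c) ℤ.* + (suc k * suc l)           ∎)
  where open ≡-Reasoning

toℚᵘ-frac : ∀ a b → .{{NonZero b}} → toℚᵘ (frac a b) ≈ a ÷ b
toℚᵘ-frac a (suc b) = ≈÷-resp-≃ (ℚP.toℚᵘ-fromℚᵘ (mkℚᵘ (+ a) b)) (mk≈÷ refl)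

toℚᵘ-prodℚ-frac : ∀ (f g : ℕ → ℕ) L → All (λ q → NonZero (g q)) L →
                  toℚᵘ (prodℚ (map (λ q → frac (f q) (g q)) L)) ≈ prodℕ (map f L) ÷ prodℕ (map g L)
toℚᵘ-prodℚ-frac f g []      []                = mk≈÷ refl
toℚᵘ-prodℚ-frac f g (q ∷ L) (g[q]≢0 ∷ g[L]≢0) = ≈÷-resp-≃ (ℚP.toℚᵘ-homo-* (frac (f q) (g q)) _)
  (≈÷-* (toℚᵘ-frac (f q) (g q) {{g[q]≢0}}) (toℚᵘ-prodℚ-frac f g L g[L]≢0))

1≤-≈÷ : ∀ {u a b} → .{{NonZero b}} → b ≤ a → u ≈ a ÷ b → 1ℚᵘ ℚᵘ.≤ u
1≤-≈÷ {mkℚᵘ e k} {a} {suc b} b≤a (mk≈÷ u≈) = ℚᵘ.*≤* (ℤP.*-cancelʳ-≤-pos _ _ (+ suc b) (begin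
  (+ 1 ℤ.* + suc k) ℤ.* + suc b   ≡⟨ cong (ℤ._* + suc b) (ℤP.*-identityˡ (+ suc k)) ⟩
  + suc k ℤ.* + suc b             ≤⟨ ℤP.*-monoˡ-≤-nonNeg (+ suc k) (ℤ.+≤+ b≤a) ⟩
  + suc k ℤ.* + a                 ≡⟨ ℤP.*-comm (+ suc k) (+ a) ⟩
  + a ℤ.* + suc k                 ≡⟨ u≈ ⟨
  e ℤ.* + suc b                   ≡⟨ cong (ℤ._* + suc b) (ℤP.*-identityʳ e) ⟨
  (e ℤ.* + 1) ℤ.* + suc b         ∎))
  where open ℤP.≤-Reasoning

toℚᵘ-D : ∀ {A B} → All (2 ≤_) A → All (2 ≤_) B →
         toℚᵘ (D A B) ≈ prod∸1 A * prodℕ B ÷ (prodℕ A * prod∸1 B)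
toℚᵘ-D {A} {B} 2≤A 2≤B =
  subst₂ (toℚᵘ (D A B) ≈_÷_) (cong (λ L → prod∸1 A * prodℕ L) (ListP.map-id B))
                             (cong (λ L → prodℕ L * prod∸1 B) (ListP.map-id A))
    (≈÷-resp-≃ (ℚP.toℚᵘ-homo-* (prodℚ (map (λ q → frac (q ∸ 1) q) A)) (prodℚ (map (λ q → frac q (q ∸ 1)) B)))
      (≈÷-* (toℚᵘ-prodℚ-frac (_∸ 1) (λ q → q) A (All.map nonZero 2≤A))
            (toℚᵘ-prodℚ-frac (λ q → q) (_∸ 1) B (All.map nonZero-∸1 2≤B))))
  where
  nonZero : ∀ {q} → 2 ≤ q → NonZero q
  nonZero (s≤s _) = _
  nonZero-∸1 : ∀ {q} → 2 ≤ q → NonZero (q ∸ 1)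
  nonZero-∸1 (s≤s (s≤s _)) = _

1≤D : ∀ A B → All (2 ≤_) A → All (2 ≤_) B → prodℕ A * prod∸1 B ≤ prod∸1 A * prodℕ B → 1ℚ ℚ.≤ D A B
1≤D A B 2≤A 2≤B cross = ℚP.toℚᵘ-cancel-≤ (1≤-≈÷ {{ℕ.>-nonZero 1≤den}} cross (toℚᵘ-D 2≤A 2≤B))
  where
  1≤den : 1 ≤ prodℕ A * prod∸1 B
  1≤den = ℕP.*-mono-≤ (ℕP.≤-trans (prod∸1-pos 2≤A) (prod∸1≤prodℕ A)) (prod∸1-pos 2≤B)

-- Counting and sieving

bool→ℕ : Bool → ℕ
bool→ℕ b = if b then 1 else 0

count : (ℕ → Bool) → ℕ → ℕ
count f zero    = 0
count f (suc m) = count f m + bool→ℕ (f m)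

count-cong : ∀ {f g} → (∀ k → f k ≡ g k) → ∀ m → count f m ≡ count g m
count-cong f≗g zero    = refl
count-cong f≗g (suc m) = cong₂ (λ c b → c + bool→ℕ b) (count-cong f≗g m) (f≗g m)

count-+ : ∀ (f : ℕ → Bool) a b → count f (a + b) ≡ count f a + count (λ i → f (a + i)) b
count-+ f a zero    = trans (cong (count f) (ℕP.+-identityʳ a)) (sym (ℕP.+-identityʳ _))
count-+ f a (suc b) = begin
  count f (a + suc b)                                         ≡⟨ cong (count f) (ℕP.+-suc a b) ⟩
  count f (a + b) + bool→ℕ (f (a + b))                        ≡⟨ cong (_+ bool→ℕ (f (a + b))) (count-+ f a b) ⟩
  count f a + count (λ i → f (a + i)) b + bool→ℕ (f (a + b))  ≡⟨ ℕP.+-assoc (count f a) _ _ ⟩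
  count f a + count (λ i → f (a + i)) (suc b)                 ∎
  where open ≡-Reasoning

count-∧-split : ∀ (f g : ℕ → Bool) m →
                count f m ≡ count (λ k → g k ∧ f k) m + count (λ k → not (g k) ∧ f k) m
count-∧-split f g zero    = refl
count-∧-split f g (suc m) = begin
  count f m + bool→ℕ (f m)
    ≡⟨ cong₂ _+_ (count-∧-split f g m) (split (g m) (f m)) ⟩
  (count gf m + count ¬gf m) + (bool→ℕ (gf m) + bool→ℕ (¬gf m))
    ≡⟨ +-Comm.interchange (count gf m) (count ¬gf m) (bool→ℕ (gf m)) (bool→ℕ (¬gf m)) ⟩
  count gf (suc m) + count ¬gf (suc m)
    ∎
  where
  open ≡-Reasoning
  gf ¬gf : ℕ → Bool
  gf k  = g k ∧ f k
  ¬gf k = not (g k) ∧ f k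
  split : ∀ b c → bool→ℕ c ≡ bool→ℕ (b ∧ c) + bool→ℕ (not b ∧ c)
  split true  c = sym (ℕP.+-identityʳ (bool→ℕ c))
  split false c = refl

count-true : ∀ m → count (λ _ → true) m ≡ m
count-true zero    = refl
count-true (suc m) = trans (cong (_+ 1) (count-true m)) (ℕP.+-comm m 1)

count-false : ∀ (f : ℕ → Bool) m → (∀ {k} → k < m → f k ≡ false) → count f m ≡ 0
count-false f zero    _     = refl
count-false f (suc m) f≡ff rewrite f≡ff (ℕP.n<1+n m) =
  trans (ℕP.+-identityʳ _) (count-false f m (f≡ff ∘ ℕP.m<n⇒m<1+n))

length-filter-upTo : ∀ {P : Pred ℕ 0ℓ} (P? : Decidable P) m →
                     length (filter P? (upTo m)) ≡ count (does ∘ P?) m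
length-filter-upTo P? zero    = refl
length-filter-upTo P? (suc m) = begin
  length (filter P? (upTo (suc m)))                       ≡⟨ cong (length ∘ filter P?) (ListP.upTo-∷ʳ m) ⟨
  length (filter P? (upTo m ++ [ m ]))                    ≡⟨ cong length (ListP.filter-++ P? (upTo m) [ m ]) ⟩
  length (filter P? (upTo m) ++ filter P? [ m ])          ≡⟨ ListP.length-++ (filter P? (upTo m)) ⟩
  length (filter P? (upTo m)) + length (filter P? [ m ])  ≡⟨ cong₂ _+_ (length-filter-upTo P? m) singleton ⟩
  count (does ∘ P?) (suc m)                               ∎
  where
  open ≡-Reasoning
  singleton : length (filter P? [ m ]) ≡ bool→ℕ (does (P? m))
  singleton with P? m
  ... | yes _ = refl
  ... | no _  = refl

module _ (h : ℕ → Bool) (r : ℕ) where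

  private
    q = suc r

    last-multiple : ∀ t → count (λ i → does (q ∣? suc (q * t + i)) ∧ h (suc (q * t + i))) q
                          ≡ bool→ℕ (h (q * suc t))
    last-multiple t = cong₂ _+_ (count-false _ r skipped) (cong bool→ℕ hit)
      where
      suc[qt+r]≡q[1+t] : suc (q * t + r) ≡ q * suc t
      suc[qt+r]≡q[1+t] = trans (sym (ℕP.+-suc (q * t) r)) (trans (ℕP.+-comm (q * t) q) (sym (ℕP.*-suc q t)))
      hit : does (q ∣? suc (q * t + r)) ∧ h (suc (q * t + r)) ≡ h (q * suc t)
      hit rewrite suc[qt+r]≡q[1+t] | dec-true (q ∣? q * suc t) (m∣m*n (suc t)) = refl
      skipped : ∀ {i} → i < r → does (q ∣? suc (q * t + i)) ∧ h (suc (q * t + i)) ≡ false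
      skipped {i} i<r = cong (_∧ h (suc (q * t + i))) (dec-false (q ∣? suc (q * t + i)) q∤)
        where
        q∤ : ¬ q ∣ suc (q * t + i)
        q∤ q∣ = ℕP.<⇒≱ (s≤s i<r) (∣⇒≤ (∣m+n∣m⇒∣n (subst (q ∣_) (sym (ℕP.+-suc (q * t) i)) q∣) (m∣m*n t)))

  count-multiples : ∀ t → count (λ k → does (q ∣? suc k) ∧ h (suc k)) (q * t) ≡ count (λ j → h (q * suc j)) t
  count-multiples zero    rewrite ℕP.*-zeroʳ r = refl
  count-multiples (suc t) = begin
    count F (q * suc t)                               ≡⟨ cong (count F) (trans (ℕP.*-suc q t) (ℕP.+-comm q (q * t))) ⟩
    count F (q * t + q)                               ≡⟨ count-+ F (q * t) q ⟩
    count F (q * t) + count (λ i → F (q * t + i)) q   ≡⟨ cong₂ _+_ (count-multiples t) (last-multiple t) ⟩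
    count (λ j → h (q * suc j)) (suc t)               ∎
    where
    open ≡-Reasoning
    F = λ k → does (q ∣? suc k) ∧ h (suc k)

Avoids : List ℕ → Pred ℕ 0ℓ
Avoids S k = All (λ s → ¬ s ∣ k) S

avoids? : ∀ S → Decidable (Avoids S)
avoids? S k = All.all? (λ s → ¬? (s ∣? k)) S

prime∣*-prime⇒∣ : ∀ {q s} x → Prime q → Prime s × q ≢ s → s ∣ q * x → s ∣ x
prime∣*-prime⇒∣ {q} x q-prime (s-prime , q≢s) s∣qx with euclidsLemma q x s-prime s∣qx
... | inj₂ s∣x = s∣x
... | inj₁ s∣q with prime⇒irreducible q-prime s∣q
...   | inj₂ s≡q = contradiction (sym s≡q) q≢s
...   | inj₁ refl = contradiction refl (ℕ.nonTrivial⇒≢1 {{prime⇒nonTrivial s-prime}})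

avoids-prime-* : ∀ {S q} x → Prime q → All (λ s → Prime s × q ≢ s) S → Avoids S (q * x) ⇔ Avoids S x
avoids-prime-* {q = q} x q-prime S-prime-≢q = mk⇔
  (All.map (_∘ ∣n⇒∣m*n q))
  (λ S∤x → All.zipWith (λ (s-prime-≢q , s∤x) → s∤x ∘ prime∣*-prime⇒∣ x q-prime s-prime-≢q) (S-prime-≢q , S∤x))

-- Sieving out one more prime q ∣ m: among 1, …, m, the numbers avoiding S that are
-- multiples of q are q·1, …, q·(m/q), and these avoid S exactly when 1, …, m/q do.
count-avoids : ∀ S m → All Prime S → Unique S → All (_∣ m) S →
               count (λ k → does (avoids? S (suc k))) m * prodℕ S ≡ m * prod∸1 S
count-avoids [] m _ _ _ = trans (ℕP.*-identityʳ _) (trans (count-true m) (sym (ℕP.*-identityʳ m)))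
count-avoids (zero ∷ S) m (0-prime ∷ _) _ _ = contradiction refl (ℕ.≢-nonZero⁻¹ 0 {{prime⇒nonZero 0-prime}})
count-avoids (q@(suc r) ∷ S) _ (q-prime ∷ S-prime) (q∉S ∷ S-unique) (divides t refl ∷ S∣tq) = begin
  C * (q * P)            ≡⟨ *-Comm.x∙yz≈y∙xz C q P ⟩
  q * (C * P)            ≡⟨ cong (q *_) C*P≡t*r*Q ⟩
  q * (t * (r * Q))      ≡⟨ *-Comm.x∙yz≈yx∙z q t (r * Q) ⟩
  t * q * (r * Q)        ∎
  where
  open ≡-Reasoning
  P = prodℕ S
  Q = prod∸1 S
  avoidsS : ℕ → Bool
  avoidsS k = does (avoids? S (suc k))
  a = count avoidsS (t * q)
  b = count avoidsS t
  C = count (λ k → does (avoids? (q ∷ S) (suc k))) (t * q)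

  S-prime-≢q : All (λ s → Prime s × q ≢ s) S
  S-prime-≢q = All.zip (S-prime , q∉S)

  S∣t : All (_∣ t) S
  S∣t = All.zipWith (λ {s} (s-prime-≢q , s∣tq) → prime∣*-prime⇒∣ t q-prime s-prime-≢q (subst (s ∣_) (ℕP.*-comm t q) s∣tq))
                    (S-prime-≢q , S∣tq)

  multiples : count (λ k → does (q ∣? suc k) ∧ avoidsS k) (t * q) ≡ b
  multiples = begin
    count (λ k → does (q ∣? suc k) ∧ avoidsS k) (t * q)   ≡⟨ cong (count _) (ℕP.*-comm t q) ⟩
    count (λ k → does (q ∣? suc k) ∧ avoidsS k) (q * t)   ≡⟨ count-multiples (does ∘ avoids? S) r t ⟩
    count (λ j → does (avoids? S (q * suc j))) t          ≡⟨ count-cong (λ j → does-⇔ (avoids-prime-* (suc j) q-prime S-prime-≢q)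
                                                                                    (avoids? S (q * suc j)) (avoids? S (suc j))) t ⟩
    b                                                      ∎

  a≡b+C : a ≡ b + C
  a≡b+C = trans (count-∧-split avoidsS (λ k → does (q ∣? suc k)) (t * q)) (cong (_+ C) multiples)

  C*P≡t*r*Q : C * P ≡ t * (r * Q)
  C*P≡t*r*Q = ℕP.+-cancelˡ-≡ (t * Q) _ _ (begin
    t * Q + C * P          ≡⟨ cong (_+ C * P) (count-avoids S t S-prime S-unique S∣t) ⟨
    b * P + C * P          ≡⟨ ℕP.*-distribʳ-+ P b C ⟨
    (b + C) * P            ≡⟨ cong (_* P) a≡b+C ⟨
    a * P                  ≡⟨ count-avoids S (t * q) S-prime S-unique S∣tq ⟩
    t * q * Q              ≡⟨ t*[1+r]*Q t r Q ⟩
    t * Q + t * (r * Q)    ∎)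
    where
    t*[1+r]*Q : ∀ t r Q → t * suc r * Q ≡ t * Q + t * (r * Q)
    t*[1+r]*Q = solve-∀

-- Prime factors, radical and totient

prime⇒2≤ : ∀ {p} → Prime p → 2 ≤ p
prime⇒2≤ {p} p-prime = ℕ.nonTrivial⇒n>1 p {{prime⇒nonTrivial p-prime}}

∃-prime-∣ : ∀ d → .{{ℕ.NonTrivial d}} → ∃[ s ] Prime s × s ∣ d
∃-prime-∣ d@(suc (suc _)) with factorise d
... | record { factors = []     ; isFactorisation = () }
... | record { factors = s ∷ ss ; isFactorisation = d≡Πss ; factorsPrime = s-prime ∷ _ } =
  s , s-prime , subst (s ∣_) (sym d≡Πss) (m∣m*n (prodℕ ss))

W-prime-∣ : ∀ x → All (λ q → Prime q × q ∣ x) (W x)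
W-prime-∣ x = AllP.all-filter (λ q → prime? q ×-dec q ∣? x) (upTo (suc x))

W-unique : ∀ x → Unique (W x)
W-unique x = UniqueP.filter⁺ (λ q → prime? q ×-dec q ∣? x) (UniqueP.upTo⁺ (suc x))

∈-W⁺ : ∀ {q x} → .{{NonZero x}} → Prime q → q ∣ x → q ∈ W x
∈-W⁺ {q} {x} q-prime q∣x = ∈P.∈-filter⁺ (λ q → prime? q ×-dec q ∣? x) (∈P.∈-upTo⁺ (s≤s (∣⇒≤ q∣x))) (q-prime , q∣x)

W-2≤ : ∀ x → All (2 ≤_) (W x)
W-2≤ x = All.map (prime⇒2≤ ∘ proj₁) (W-prime-∣ x)

rad≢0 : ∀ x → NonZero (rad x)
rad≢0 x = product≢0 (All.map (prime⇒nonZero ∘ proj₁) (W-prime-∣ x))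

prod-primes-∣ : ∀ {S x} → All Prime S → Unique S → All (_∣ x) S → prodℕ S ∣ x
prod-primes-∣ {[]}    {x} _ _ _ = 1∣ x
prod-primes-∣ {q ∷ S} (q-prime ∷ S-prime) (q∉S ∷ S-unique) (q∣x ∷ S∣x)
  with divides k x≡k*ΠS ← prod-primes-∣ S-prime S-unique S∣x
  with euclidsLemma k (prodℕ S) q-prime (subst (q ∣_) x≡k*ΠS q∣x)
... | inj₁ q∣k  = subst (q * prodℕ S ∣_) (sym x≡k*ΠS) (*-pres-∣ q∣k (∣-refl {prodℕ S}))
... | inj₂ q∣ΠS = contradiction refl (All.lookup q∉S (factorisationHasAllPrimeFactors q-prime q∣ΠS S-prime))

rad∣ : ∀ x → rad x ∣ x
rad∣ x = prod-primes-∣ (All.map proj₁ (W-prime-∣ x)) (W-unique x) (All.map proj₂ (W-prime-∣ x))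

Coprime⇔Avoids-W : ∀ a x → .{{NonZero x}} → Coprime a x ⇔ Avoids (W x) a
Coprime⇔Avoids-W a x = mk⇔ to from
  where
  to : Coprime a x → Avoids (W x) a
  to coprime = All.map (λ (q-prime , q∣x) q∣a → ℕ.nonTrivial⇒≢1 {{prime⇒nonTrivial q-prime}} (coprime (q∣a , q∣x)))
                       (W-prime-∣ x)
  from : Avoids (W x) a → Coprime a x
  from avoids {zero}            (_ , 0∣x)   = contradiction (0∣⇒≡0 0∣x) (ℕ.≢-nonZero⁻¹ x)
  from avoids {suc zero}        _           = refl
  from avoids {d@(suc (suc _))} (d∣a , d∣x) with s , s-prime , s∣d ← ∃-prime-∣ d =
    contradiction (∣-trans s∣d d∣a) (All.lookup avoids (∈-W⁺ s-prime (∣-trans s∣d d∣x)))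

φ≡count-avoids : ∀ x → .{{NonZero x}} → φ x ≡ count (λ k → does (avoids? (W x) (suc k))) x
φ≡count-avoids x = begin
  length (filter (λ k → coprime? (suc k) x) (upTo x))   ≡⟨ cong length (ListP.filter-≐ _ _ coprime≐avoids (upTo x)) ⟩
  length (filter (avoids? (W x) ∘ suc) (upTo x))        ≡⟨ length-filter-upTo (avoids? (W x) ∘ suc) x ⟩
  count (λ k → does (avoids? (W x) (suc k))) x          ∎
  where
  open ≡-Reasoning
  coprime≐avoids = (λ {k} → Equivalence.to (Coprime⇔Avoids-W (suc k) x))
                 , (λ {k} → Equivalence.from (Coprime⇔Avoids-W (suc k) x))

φ*rad : ∀ x → .{{NonZero x}} → φ x * rad x ≡ x * prod∸1 (W x)
φ*rad x = trans (cong (_* rad x) (φ≡count-avoids x))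
  (count-avoids (W x) x (All.map proj₁ (W-prime-∣ x)) (W-unique x) (All.map proj₂ (W-prime-∣ x)))

prod∸1-W≤φ : ∀ y → .{{NonZero y}} → prod∸1 (W y) ≤ φ y
prod∸1-W≤φ y = ℕP.*-cancelʳ-≤ _ _ (rad y) {{rad≢0 y}} (begin
  prod∸1 (W y) * rad y   ≤⟨ ℕP.*-monoʳ-≤ (prod∸1 (W y)) (∣⇒≤ (rad∣ y)) ⟩
  prod∸1 (W y) * y       ≡⟨ ℕP.*-comm (prod∸1 (W y)) y ⟩
  y * prod∸1 (W y)       ≡⟨ φ*rad y ⟨
  φ y * rad y            ∎)
  where open ℕP.≤-Reasoning

2≤rad : ∀ n → .{{ℕ.NonTrivial n}} → 2 ≤ rad n
2≤rad n with s , s-prime , s∣n ← ∃-prime-∣ n =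
  ℕP.≤-trans (prime⇒2≤ s-prime) (∣⇒≤ {{rad≢0 n}} (∈⇒∣product (∈-W⁺ {{ℕ.nonTrivial⇒nonZero n}} s-prime s∣n)))

*-divℕ : ∀ {d n} → .{{NonZero d}} → d ∣ n → d * divℕ n d ≡ n
*-divℕ {suc _} d∣n = m*[n/m]≡n d∣n

rad*divℕ : ∀ n → rad n * divℕ n (rad n) ≡ n
rad*divℕ n = *-divℕ {{rad≢0 n}} (rad∣ n)

divℕ-rad-< : ∀ {n p} → 2 ≤ n → n < 2 * p → divℕ n (rad n) < p
divℕ-rad-< {n} {p} 2≤n n<2p = ℕP.*-cancelˡ-< 2 _ p (begin-strict
  2 * divℕ n (rad n)        ≤⟨ ℕP.*-monoˡ-≤ (divℕ n (rad n)) (2≤rad n {{ℕ.n>1⇒nonTrivial 2≤n}}) ⟩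
  rad n * divℕ n (rad n)    ≡⟨ rad*divℕ n ⟩
  n                         <⟨ n<2p ⟩
  2 * p                     ∎)
  where open ℕP.≤-Reasoning

divℕ-rad≢0 : ∀ n → .{{NonZero n}} → NonZero (divℕ n (rad n))
divℕ-rad≢0 n = ℕ.≢-nonZero λ n/rad≡0 →
  ℕ.≢-nonZero⁻¹ n (trans (sym (rad*divℕ n)) (trans (cong (rad n *_) n/rad≡0) (ℕP.*-zeroʳ (rad n))))

-- Primes up to p

∈-primesUpTo⁻ : ∀ {k p} → k ∈ primesUpTo p → Prime k × k ≤ p
∈-primesUpTo⁻ k∈ with k∈upTo , k-prime ← ∈P.∈-filter⁻ prime? k∈ = k-prime , ℕP.≤-pred (∈P.∈-upTo⁻ k∈upTo)

∈-primesUpTo⁺ : ∀ {k p} → Prime k → k ≤ p → k ∈ primesUpTo p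
∈-primesUpTo⁺ k-prime k≤p = ∈P.∈-filter⁺ prime? (∈P.∈-upTo⁺ (s≤s k≤p)) k-prime

primesUpTo-prime-≤ : ∀ p → All (λ k → Prime k × k ≤ p) (primesUpTo p)
primesUpTo-prime-≤ p = All.tabulate ∈-primesUpTo⁻

primesUpTo-2≤ : ∀ p → All (2 ≤_) (primesUpTo p)
primesUpTo-2≤ p = All.map (prime⇒2≤ ∘ proj₁) (primesUpTo-prime-≤ p)

module _ {m p : ℕ} .{{_ : NonZero m}} (m≤p : m ≤ p) where

  private
    P = prodℕ (primesUpTo p)
    primesUpTo-prime : All Prime (primesUpTo p)
    primesUpTo-prime = All.map proj₁ (primesUpTo-prime-≤ p)
    instance
      P≢0 : NonZero P
      P≢0 = product≢0 (All.map prime⇒nonZero primesUpTo-prime)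
      mP≢0 : NonZero (m * P)
      mP≢0 = ℕP.m*n≢0 m P

  W-*-primorial : W (m * P) ≡ primesUpTo p
  W-*-primorial = filter-upTo-≐ (λ q → prime? q ×-dec q ∣? m * P) prime? (suc (m * P)) (suc p)
                                (λ _ → mk⇔ to from)
    where
    divisor≤p : ∀ {k} → Prime k → k ∣ m * P → k ≤ p
    divisor≤p k-prime k∣mP with euclidsLemma m P k-prime k∣mP
    ... | inj₁ k∣m = ℕP.≤-trans (∣⇒≤ k∣m) m≤p
    ... | inj₂ k∣P = proj₂ (∈-primesUpTo⁻ (factorisationHasAllPrimeFactors k-prime k∣P primesUpTo-prime))
    to : ∀ {k} → k < suc (m * P) × Prime k × k ∣ m * P → k < suc p × Prime k
    to (_ , k-prime , k∣mP) = s≤s (divisor≤p k-prime k∣mP) , k-prime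
    from : ∀ {k} → k < suc p × Prime k → k < suc (m * P) × Prime k × k ∣ m * P
    from (s≤s k≤p , k-prime) = s≤s (∣⇒≤ k∣mP) , k-prime , k∣mP
      where k∣mP = ∣n⇒∣m*n m (∈⇒∣product (∈-primesUpTo⁺ k-prime k≤p))

  φ-*-primorial : φ (m * P) ≡ m * prod∸1 (primesUpTo p)
  φ-*-primorial = ℕP.*-cancelʳ-≡ _ _ P (begin
    φ (m * P) * P                               ≡⟨ cong (λ L → φ (m * P) * prodℕ L) W-*-primorial ⟨
    φ (m * P) * rad (m * P)                     ≡⟨ φ*rad (m * P) ⟩
    m * P * prod∸1 (W (m * P))                  ≡⟨ cong (λ L → m * P * prod∸1 L) W-*-primorial ⟩
    m * P * prod∸1 (primesUpTo p)               ≡⟨ *-Comm.xy∙z≈xz∙y m P _ ⟩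
    m * prod∸1 (primesUpTo p) * P               ∎)
    where open ≡-Reasoning

filter-≤-W : ∀ y c → .{{NonZero y}} → filter (_≤? c) (W y) ≡ filter (_∣? y) (primesUpTo c)
filter-≤-W y c = begin
  filter (_≤? c) (W y)                  ≡⟨ filter-filter (_≤? c) prime∣y? (upTo (suc y)) ⟩
  filter prime∣y≤c? (upTo (suc y))      ≡⟨ filter-upTo-≐ prime∣y≤c? prime∣y? (suc y) (suc c) (λ _ → mk⇔ to from) ⟩
  filter prime∣y? (upTo (suc c))        ≡⟨ filter-filter (_∣? y) prime? (upTo (suc c)) ⟨
  filter (_∣? y) (primesUpTo c)         ∎
  where
  open ≡-Reasoning
  prime∣y? = λ k → prime? k ×-dec k ∣? y
  prime∣y≤c? = λ k → prime∣y? k ×-dec k ≤? c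
  to : ∀ {k} → k < suc y × (Prime k × k ∣ y) × k ≤ c → k < suc c × Prime k × k ∣ y
  to (_ , k-prime-∣ , k≤c) = s≤s k≤c , k-prime-∣
  from : ∀ {k} → k < suc c × Prime k × k ∣ y → k < suc y × (Prime k × k ∣ y) × k ≤ c
  from (s≤s k≤c , k-prime , k∣y) = s≤s (∣⇒≤ k∣y) , (k-prime , k∣y) , k≤c

W-primesUpTo-exchange : ∀ y c → .{{NonZero y}} → 1 ≤ c →
  prodℕ (W y) * prod∸1 (primesUpTo c) ≤ prod∸1 (W y) * prodℕ (primesUpTo c)
  ⊎ c * prod∸1 (primesUpTo c) ≤ prod∸1 (W y)
W-primesUpTo-exchange y c 1≤c = Sum.map cross large (prod-exchange c C U V 1≤c c<U V≤c)
  where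
  C = filter (_≤? c) (W y)
  U = filter (¬? ∘ (_≤? c)) (W y)
  V = filter (¬? ∘ (_∣? y)) (primesUpTo c)
  c<U : All (c <_) U
  c<U = All.map ℕP.≰⇒> (AllP.all-filter (¬? ∘ (_≤? c)) (W y))
  V≤c : All (_≤ c) V
  V≤c = AllP.filter⁺ (¬? ∘ (_∣? y)) (All.map proj₂ (primesUpTo-prime-≤ c))
  Π[W] : prodℕ (W y) ≡ prodℕ C * prodℕ U
  Π[W] = prodℕ-partition (_≤? c) (W y)
  Π′[W] : prod∸1 (W y) ≡ prod∸1 C * prod∸1 U
  Π′[W] = prodℕ-map-partition (_≤? c) (_∸ 1) (W y)
  Π[B] : prodℕ (primesUpTo c) ≡ prodℕ C * prodℕ V
  Π[B] = trans (prodℕ-partition (_∣? y) (primesUpTo c))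
               (cong (λ L → prodℕ L * prodℕ V) (sym (filter-≤-W y c)))
  Π′[B] : prod∸1 (primesUpTo c) ≡ prod∸1 C * prod∸1 V
  Π′[B] = trans (prodℕ-map-partition (_∣? y) (_∸ 1) (primesUpTo c))
                (cong (λ L → prod∸1 L * prod∸1 V) (sym (filter-≤-W y c)))
  cross = subst₂ _≤_ (sym (cong₂ _*_ Π[W] Π′[B])) (sym (cong₂ _*_ Π′[W] Π[B]))
  large = subst₂ _≤_ (sym (cong (c *_) Π′[B])) (sym Π′[W])

lemma8 : (p y n : ℕ) → Prime p → 1 ≤ y → 2 ≤ n → n < 2 * p →
         φ y ≤ φ (X n p) → 1ℚ ℚ.≤ D (W y) (W (X n p))
lemma8 p y n p-prime 1≤y 2≤n n<2p φy≤φX =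
  subst (λ L → 1ℚ ℚ.≤ D (W y) L) (sym W[X]≡B) (1≤D (W y) B (W-2≤ y) (primesUpTo-2≤ p) balanced)
  where
  instance
    y≢0 : NonZero y
    y≢0 = ℕ.>-nonZero 1≤y
    m≢0 : NonZero (divℕ n (rad n))
    m≢0 = divℕ-rad≢0 n {{ℕ.>-nonZero (ℕP.<-trans ℕ.z<s 2≤n)}}
  m = divℕ n (rad n)
  B = primesUpTo p
  m<p : m < p
  m<p = divℕ-rad-< 2≤n n<2p
  W[X]≡B : W (X n p) ≡ B
  W[X]≡B = W-*-primorial (ℕP.<⇒≤ m<p)
  balanced : prodℕ (W y) * prod∸1 B ≤ prod∸1 (W y) * prodℕ B
  balanced with W-primesUpTo-exchange y p (ℕP.<⇒≤ (prime⇒2≤ p-prime))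
  ... | inj₁ balanced = balanced
  ... | inj₂ large = contradiction φy≤φX (ℕP.<⇒≱ (begin-strict
    φ (X n p)       ≡⟨ φ-*-primorial (ℕP.<⇒≤ m<p) ⟩
    m * prod∸1 B    <⟨ ℕP.*-monoˡ-< (prod∸1 B) {{ℕ.>-nonZero (prod∸1-pos (primesUpTo-2≤ p))}} m<p ⟩
    p * prod∸1 B    ≤⟨ large ⟩
    prod∸1 (W y)    ≤⟨ prod∸1-W≤φ y ⟩
    φ y             ∎))
    where open ℕP.≤-Reasoning
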